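{- Let $r\geq 4$ be an integer and let $G$ be a nearly $r$-regular graph such that $|V(G)|\leq 2r-1$ and $|V(G)|$ is odd. Then for any vertex $v\in V(G)$ and any edge $e\in E(G)$, the graph $G-v-e$ has a perfect matching.
   Context: All graphs are finite and simple. A graph is nearly $r$-regular if all vertices have degree $r$ except exactly one vertex, which has degree $r-1$. $G-v-e$ denotes the graph obtained from $G$ by deleting the vertex $v$ (with its incident edges) and the edge $e$ (if still present). -}

module Defs where

open import Data.Nat using (ℕ; _∸_)
open import Data.Fin using (Fin)
open import Data.Bool using (Bool; true; false)
open import Data.List using (List; filter; length)
open import Data.Fin.Base using ()
open import Data.List.Base using ()
open import Data.Product using (Σ; _×_; ∃)
open import Relation.Nullary using (¬_)
open import Relation.Binary.PropositionalEquality using (_≡_; _≢_)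
open import Data.Bool.Properties using () renaming (_≟_ to _≟ᵇ_)
import Data.List as L
import Data.Fin as F

record Graph (n : ℕ) : Set where
  field
    adj    : Fin n → Fin n → Bool
    sym    : ∀ x y → adj x y ≡ adj y x
    irrefl : ∀ x → adj x x ≡ false
open Graph public

allVertices : (n : ℕ) → List (Fin n)
allVertices n = L.allFin n

deg : ∀ {n} → Graph n → Fin n → ℕ
deg {n} G x = length (filter (λ y → adj G x y ≟ᵇ true) (allVertices n))

NearlyRegular : ∀ {n} → ℕ → Graph n → Set
NearlyRegular {n} r G =
  Σ (Fin n) λ w → (deg G w ≡ r ∸ 1) × (∀ x → x ≢ w → deg G x ≡ r)

record Edge {n : ℕ} (G : Graph n) : Set where
  constructor edge
  field
    end₁ end₂ : Fin n
    isEdge    : adj G end₁ end₂ ≡ true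
open Edge public

SameEdge : ∀ {n} {G : Graph n} → Edge G → Fin n → Fin n → Set
SameEdge e x y = (x ≡ end₁ e × y ≡ end₂ e) Data.Sum.⊎ (x ≡ end₂ e × y ≡ end₁ e)
  where import Data.Sum

PerfectMatchingMinus : ∀ {n} (G : Graph n) → Fin n → Edge G → Set
PerfectMatchingMinus {n} G v e =
  Σ (Fin n → Fin n) λ m → ∀ x → x ≢ v →
      (m x ≢ v) × (m (m x) ≡ x) × (adj G x (m x) ≡ true) × ¬ SameEdge e x (m x)

Odd : ℕ → Set
Odd n = ∃ λ k → n ≡ Data.Nat.suc (2 Data.Nat.* k)
  where import Data.Nat

-- Work in H = G − v − e and grow a matching, encoded as an involution whose fixed points are
-- the exposed vertices. The vertex v is isolated in H, hence always exposed, and n is odd, so the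
-- goal is a matching that exposes v alone. Given exposed a, b ≠ v, either an augmenting path of
-- length 1 or 3 joins them, or the pair is blocked: then the neighbours of a and the partners of
-- the neighbours of b are disjoint sets of matched vertices, so deg a + deg b ≤ n − 3 ≤ 2r − 4.
-- As deg x ≥ r − 1 − defect x, where defect x counts the occurrences of x among w (the vertex of
-- degree r − 1) and the two ends of e, and the defects sum to 3, a blocked pair has total defect
-- at least 2. Taking defect b ≤ defect a, some neighbour x of a has a partner y with
-- defect y + defect b ≤ 1 (this is where r ≥ 4 enters); re-matching x to a exposes y instead of a,
-- and the pair y, b cannot be blocked, so it augments.

module Submission where

open import Data.Nat using (ℕ; zero; suc; _≤_; _<_; _+_; _*_; _∸_; z≤n; s≤s; _<ᵇ_; _≤?_)
open import Data.Nat.Properties renaming (_≟_ to _≟ℕ_)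
open import Data.Nat.Tactic.RingSolver using (solve-∀)
open import Data.Fin using (Fin; zero; suc; _≟_; punchIn)
open import Data.Fin.Properties using (punchInᵢ≢i; any?)
open import Data.Fin.Permutation using (permutation)
open import Data.Bool using (Bool; true; false; not; _∧_; _∨_; if_then_else_; T)
open import Data.Bool.Properties
  using (∧-comm; ∨-comm; ∧-zeroʳ; ∨-zeroʳ; ∧-conicalˡ; ∧-conicalʳ; ∨-conicalˡ; ∨-conicalʳ;
         not-¬)
  renaming (_≟_ to _≟ᵇ_)
open import Data.List using (length; filter; tabulate)
open import Data.Product using (Σ; ∃; ∃₂; _×_; _,_; proj₁; proj₂)
open import Data.Sum using (_⊎_; inj₁; inj₂; [_,_]′)
open import Data.Empty using (⊥-elim)
open import Data.Unit using (tt)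
open import Function using (_∘_)
open import Relation.Nullary using (does; ¬_; yes; no)
open import Relation.Nullary.Decidable using (dec-true; dec-false; _×-dec_)
open import Relation.Binary.PropositionalEquality
open import Algebra.Properties.Semiring.Sum +-*-semiring
  using (sum; ∑-distrib-+; sum-cong-≗; sum-permute; sum-remove; sum-replicate-zero; *-distribˡ-sum)
open import Defs renaming (sym to adj-sym)

-- Counting over Fin n

𝟙 : Bool → ℕ
𝟙 true  = 1
𝟙 false = 0

count : ∀ {n} → (Fin n → Bool) → ℕ
count P = sum (λ i → 𝟙 (P i))

_==_ : ∀ {n} → Fin n → Fin n → Bool
x == y = does (x ≟ y)

==-refl : ∀ {n} (x : Fin n) → x == x ≡ true
==-refl x = dec-true (x ≟ x) refl

==-≢ : ∀ {n} {x y : Fin n} → x ≢ y → x == y ≡ false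
==-≢ {x = x} {y} = dec-false (x ≟ y)

==⇒≡ : ∀ {n} {x y : Fin n} → x == y ≡ true → x ≡ y
==⇒≡ {x = x} {y} eq with x ≟ y | eq
... | yes x≡y | _ = x≡y
... | no _    | ()

==-false⇒≢ : ∀ {n} {x y : Fin n} → x == y ≡ false → x ≢ y
==-false⇒≢ {x = x} x==y refl with trans (sym x==y) (==-refl x)
... | ()

δ : ∀ {n} → Fin n → Fin n → ℕ
δ c i = 𝟙 (i == c)

sum-mono-≤ : ∀ {n} {f g : Fin n → ℕ} → (∀ i → f i ≤ g i) → sum f ≤ sum g
sum-mono-≤ {zero}  f≤g = z≤n
sum-mono-≤ {suc n} f≤g = +-mono-≤ (f≤g zero) (sum-mono-≤ (f≤g ∘ suc))

sum-ones : ∀ n → sum {n} (λ _ → 1) ≡ n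
sum-ones zero    = refl
sum-ones (suc n) = cong suc (sum-ones n)

sum-δ : ∀ {n} (c : Fin n) → sum (δ c) ≡ 1
sum-δ {suc n} c = begin
  sum (δ c)                      ≡⟨ sum-remove {i = c} (δ c) ⟩
  δ c c + sum (δ c ∘ punchIn c)  ≡⟨ cong₂ _+_ (cong 𝟙 (==-refl c))
                                              (sum-cong-≗ (λ j → cong 𝟙 (==-≢ (punchInᵢ≢i c j)))) ⟩
  1 + sum {n} (λ _ → 0)          ≡⟨ cong suc (sum-replicate-zero n) ⟩
  1                              ∎
  where open ≡-Reasoning

sum-scaled-δ : ∀ {n} (k : ℕ) (c : Fin n) → sum (λ i → k * δ c i) ≡ k
sum-scaled-δ k c = begin
  sum (λ i → k * δ c i)  ≡⟨ *-distribˡ-sum k (δ c) ⟨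
  k * sum (δ c)          ≡⟨ cong (k *_) (sum-δ c) ⟩
  k * 1                  ≡⟨ *-identityʳ k ⟩
  k                      ∎
  where open ≡-Reasoning

sum-involution : ∀ {n} (σ : Fin n → Fin n) → (∀ i → σ (σ i) ≡ i) →
                 (f : Fin n → ℕ) → sum (f ∘ σ) ≡ sum f
sum-involution σ σ-inv f = sym (sum-permute f (permutation σ σ σ-inv σ-inv))

count-witness : ∀ {n} (P : Fin n → Bool) → 0 < count P → ∃ λ i → P i ≡ true
count-witness {suc n} P 0<count with P zero in P0
... | true  = zero , P0
... | false = let (i , Pi) = count-witness (P ∘ suc) 0<count in suc i , Pi

count-exceeds : ∀ {n} (P Q : Fin n → Bool) → count Q < count P →
                ∃ λ i → P i ≡ true × Q i ≡ false
count-exceeds P Q Q<P =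
  let i , PQi = count-witness P∖Q (+-cancelʳ-< (count Q) 0 (count P∖Q) Q<P∖Q+Q) in i , ∧-not PQi
  where
  P∖Q = λ i → P i ∧ not (Q i)
  split : ∀ p q → 𝟙 p ≤ 𝟙 (p ∧ not q) + 𝟙 q
  split false q     = z≤n
  split true  false = s≤s z≤n
  split true  true  = s≤s z≤n
  Q<P∖Q+Q : 0 + count Q < count P∖Q + count Q
  Q<P∖Q+Q = <-≤-trans Q<P (≤-trans (sum-mono-≤ (λ i → split (P i) (Q i)))
              (≤-reflexive (∑-distrib-+ (λ i → 𝟙 (P∖Q i)) (λ i → 𝟙 (Q i)))))
  ∧-not : ∀ {p q} → p ∧ not q ≡ true → p ≡ true × q ≡ false
  ∧-not {true} {false} _ = refl , refl

count-∨-≤ : ∀ {n} (P Q : Fin n → Bool) → count (λ i → P i ∨ Q i) ≤ count P + count Q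
count-∨-≤ P Q = ≤-trans (sum-mono-≤ (λ i → split (P i) (Q i)))
                        (≤-reflexive (∑-distrib-+ (λ i → 𝟙 (P i)) (λ i → 𝟙 (Q i))))
  where
  split : ∀ p q → 𝟙 (p ∨ q) ≤ 𝟙 p + 𝟙 q
  split true  q = s≤s z≤n
  split false q = ≤-refl

count+two-points-≤-sum : ∀ {n} (f : Fin n → ℕ) (P : Fin n → Bool) {a b : Fin n} → a ≢ b →
                        P a ≡ false → P b ≡ false → (∀ i → P i ≡ true → 1 ≤ f i) →
                        count P + f a + f b ≤ sum f
count+two-points-≤-sum f P {a} {b} a≢b Pa Pb P⇒f = begin
  count P + f a + f b
    ≡⟨ cong₂ (λ x y → count P + x + y) (sum-scaled-δ (f a) a) (sum-scaled-δ (f b) b) ⟨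
  count P + sum (λ i → f a * δ a i) + sum (λ i → f b * δ b i)
    ≡⟨ cong (_+ sum (λ i → f b * δ b i)) (∑-distrib-+ (λ i → 𝟙 (P i)) (λ i → f a * δ a i)) ⟨
  sum (λ i → 𝟙 (P i) + f a * δ a i) + sum (λ i → f b * δ b i)
    ≡⟨ ∑-distrib-+ (λ i → 𝟙 (P i) + f a * δ a i) (λ i → f b * δ b i) ⟨
  sum (λ i → 𝟙 (P i) + f a * δ a i + f b * δ b i)
    ≤⟨ sum-mono-≤ pointwise ⟩
  sum f ∎
  where
  open ≤-Reasoning
  pointwise : ∀ i → 𝟙 (P i) + f a * δ a i + f b * δ b i ≤ f i
  pointwise i with i ≟ a
  ... | yes refl rewrite Pa | ==-≢ a≢b | *-identityʳ (f a) | *-zeroʳ (f b)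
                       | +-identityʳ (f a) = ≤-refl
  ... | no i≢a with i ≟ b
  ...   | yes refl rewrite Pb | *-identityʳ (f b) | *-zeroʳ (f a) = ≤-refl
  ...   | no i≢b rewrite *-zeroʳ (f a) | *-zeroʳ (f b) | +-identityʳ (𝟙 (P i))
                       | +-identityʳ (𝟙 (P i)) with P i in Pi
  ...     | false = z≤n
  ...     | true  = P⇒f i Pi

two-points-≤-sum : ∀ {n} (f : Fin n → ℕ) {a b : Fin n} → a ≢ b → f a + f b ≤ sum f
two-points-≤-sum {n} f a≢b = subst (_≤ sum f) (cong (λ z → z + _ + _) (sum-replicate-zero n))
  (count+two-points-≤-sum f (λ _ → false) a≢b refl refl (λ _ ()))

count-complement : ∀ {n} (P : Fin n → Bool) → count (not ∘ P) + count P ≡ n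
count-complement {n} P = begin
  count (not ∘ P) + count P          ≡⟨ ∑-distrib-+ (λ i → 𝟙 (not (P i))) (λ i → 𝟙 (P i)) ⟨
  sum (λ i → 𝟙 (not (P i)) + 𝟙 (P i))  ≡⟨ sum-cong-≗ (λ i → complement (P i)) ⟩
  sum {n} (λ _ → 1)                  ≡⟨ sum-ones n ⟩
  n                                  ∎
  where
  open ≡-Reasoning
  complement : ∀ p → 𝟙 (not p) + 𝟙 p ≡ 1
  complement true  = refl
  complement false = refl

count-drop-two : ∀ {n} (P Q : Fin n → Bool) {a b : Fin n} → a ≢ b →
                 P a ≡ true → P b ≡ true → Q a ≡ false → Q b ≡ false →
                 (∀ i → i ≢ a → i ≢ b → Q i ≡ P i) → count Q + 2 ≡ count P
count-drop-two P Q {a} {b} a≢b Pa Pb Qa Qb Q≗P = begin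
  count Q + 2
    ≡⟨ +-assoc (count Q) 1 1 ⟨
  count Q + 1 + 1
    ≡⟨ cong₂ (λ x y → count Q + x + y) (sum-δ a) (sum-δ b) ⟨
  count Q + sum (δ a) + sum (δ b)
    ≡⟨ cong (_+ sum (δ b)) (∑-distrib-+ (λ i → 𝟙 (Q i)) (δ a)) ⟨
  sum (λ i → 𝟙 (Q i) + δ a i) + sum (δ b)
    ≡⟨ ∑-distrib-+ (λ i → 𝟙 (Q i) + δ a i) (δ b) ⟨
  sum (λ i → 𝟙 (Q i) + δ a i + δ b i)
    ≡⟨ sum-cong-≗ pointwise ⟩
  count P ∎
  where
  open ≡-Reasoning
  pointwise : ∀ i → 𝟙 (Q i) + δ a i + δ b i ≡ 𝟙 (P i)
  pointwise i with i ≟ a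
  ... | yes refl rewrite Pa | Qa | ==-≢ a≢b = refl
  ... | no i≢a with i ≟ b
  ...   | yes refl rewrite Pb | Qb = refl
  ...   | no i≢b rewrite Q≗P i i≢a i≢b | +-identityʳ (𝟙 (P i)) = +-identityʳ (𝟙 (P i))

count-filter-tabulate : ∀ {m k} (P : Fin m → Bool) (f : Fin k → Fin m) →
  length (filter (λ y → P y ≟ᵇ true) (tabulate f)) ≡ count (P ∘ f)
count-filter-tabulate {k = zero}  P f = refl
count-filter-tabulate {k = suc k} P f with P (f zero)
... | true  = cong suc (count-filter-tabulate P (f ∘ suc))
... | false = count-filter-tabulate P (f ∘ suc)

-- Matchings in a graph

adjacent⇒≢ : ∀ {n} (H : Graph n) {x y : Fin n} → adj H x y ≡ true → x ≢ y
adjacent⇒≢ H {x} adj-xy refl with trans (sym adj-xy) (irrefl H x)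
... | ()

deg≡count : ∀ {n} (H : Graph n) x → deg H x ≡ count (adj H x)
deg≡count H x = count-filter-tabulate (adj H x) (λ y → y)

locate : ∀ {n} (a b z : Fin n) → z ≡ a ⊎ z ≡ b ⊎ z ≢ a × z ≢ b
locate a b z with z ≟ a | z ≟ b
... | yes z≡a | _       = inj₁ z≡a
... | no _    | yes z≡b = inj₂ (inj₁ z≡b)
... | no z≢a  | no z≢b  = inj₂ (inj₂ (z≢a , z≢b))

record Matching {n : ℕ} (H : Graph n) : Set where
  field
    partner            : Fin n → Fin n
    partner-involutive : ∀ x → partner (partner x) ≡ x
    partner-adjacent   : ∀ x → partner x ≢ x → adj H x (partner x) ≡ true
open Matching public

module _ {n : ℕ} {H : Graph n} where

  exposed : Matching H → Fin n → Bool
  exposed M x = partner M x == x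

  #exposed : Matching H → ℕ
  #exposed M = count (exposed M)

  exposed-true : (M : Matching H) {x : Fin n} → partner M x ≡ x → exposed M x ≡ true
  exposed-true M {x} x-exp = trans (cong (_== x) x-exp) (==-refl x)

  exposed-false : (M : Matching H) {x : Fin n} → partner M x ≢ x → exposed M x ≡ false
  exposed-false M = ==-≢

  partner-injective : (M : Matching H) {x y : Fin n} → partner M x ≡ partner M y → x ≡ y
  partner-injective M {x} {y} eq =
    trans (sym (partner-involutive M x)) (trans (cong (partner M) eq) (partner-involutive M y))

  partner-≢-exposed : (M : Matching H) {a x : Fin n} → partner M a ≡ a → x ≢ a → partner M x ≢ a
  partner-≢-exposed M a-exp x≢a eq = x≢a (partner-injective M (trans eq (sym a-exp)))

  empty-matching : Matching H
  empty-matching = record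
    { partner            = λ x → x
    ; partner-involutive = λ _ → refl
    ; partner-adjacent   = λ x x≢x → ⊥-elim (x≢x refl)
    }

  #exposed-empty : #exposed empty-matching ≡ n
  #exposed-empty = trans (sum-cong-≗ {n} (λ x → cong 𝟙 (==-refl x))) (sum-ones n)

  Augmentation : Matching H → Set
  Augmentation M = Σ (Matching H) λ M′ → #exposed M′ + 2 ≡ #exposed M

  transport-augmentation : {M M′ : Matching H} → #exposed M′ ≡ #exposed M →
                           Augmentation M′ → Augmentation M
  transport-augmentation #exp′≡#exp (M″ , M″-augments) = M″ , trans M″-augments #exp′≡#exp

  module _ (M : Matching H) {a b : Fin n} (a-exp : partner M a ≡ a) (b-exp : partner M b ≡ b)
           (ab : adj H a b ≡ true) where

    private
      σ = partner M
      a≢b = adjacent⇒≢ H ab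
      b≢a = a≢b ∘ sym

    match-partner : Fin n → Fin n
    match-partner z = if z == a then b else if z == b then a else σ z

    match-partner-a : match-partner a ≡ b
    match-partner-a rewrite ==-refl a = refl

    match-partner-b : match-partner b ≡ a
    match-partner-b rewrite ==-≢ b≢a | ==-refl b = refl

    match-partner-other : ∀ {z} → z ≢ a → z ≢ b → match-partner z ≡ σ z
    match-partner-other z≢a z≢b rewrite ==-≢ z≢a | ==-≢ z≢b = refl

    match : Matching H
    match = record
      { partner            = match-partner
      ; partner-involutive = involutive
      ; partner-adjacent   = adjacent
      }
      where
      involutive : ∀ z → match-partner (match-partner z) ≡ z
      involutive z with locate a b z
      ... | inj₁ refl                = trans (cong match-partner match-partner-a) match-partner-b
      ... | inj₂ (inj₁ refl)         = trans (cong match-partner match-partner-b) match-partner-a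
      ... | inj₂ (inj₂ (z≢a , z≢b)) = begin
        match-partner (match-partner z) ≡⟨ cong match-partner (match-partner-other z≢a z≢b) ⟩
        match-partner (σ z)             ≡⟨ match-partner-other (partner-≢-exposed M a-exp z≢a)
                                                                (partner-≢-exposed M b-exp z≢b) ⟩
        σ (σ z)                         ≡⟨ partner-involutive M z ⟩
        z                               ∎
        where open ≡-Reasoning
      adjacent : ∀ z → match-partner z ≢ z → adj H z (match-partner z) ≡ true
      adjacent z z-mat with locate a b z
      ... | inj₁ refl                rewrite match-partner-a = ab
      ... | inj₂ (inj₁ refl)         rewrite match-partner-b = trans (adj-sym H b a) ab
      ... | inj₂ (inj₂ (z≢a , z≢b)) rewrite match-partner-other z≢a z≢b =
        partner-adjacent M z z-mat

    match-augments : #exposed match + 2 ≡ #exposed M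
    match-augments = count-drop-two (exposed M) (exposed match) a≢b
      (exposed-true M a-exp) (exposed-true M b-exp)
      (exposed-false match (b≢a ∘ trans (sym match-partner-a)))
      (exposed-false match (a≢b ∘ trans (sym match-partner-b)))
      (λ z z≢a z≢b → cong (_== z) (match-partner-other z≢a z≢b))

  augment-by-edge : (M : Matching H) {a b : Fin n} → partner M a ≡ a → partner M b ≡ b →
                    adj H a b ≡ true → Augmentation M
  augment-by-edge M a-exp b-exp ab = match M a-exp b-exp ab , match-augments M a-exp b-exp ab

  module _ (M : Matching H) {x : Fin n} (x-mat : partner M x ≢ x) where

    private
      σ = partner M
      y = σ x
      x≢y = x-mat ∘ sym

    unmatch-partner : Fin n → Fin n
    unmatch-partner z = if z == x then x else if z == y then y else σ z

    unmatch-partner-x : unmatch-partner x ≡ x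
    unmatch-partner-x rewrite ==-refl x = refl

    unmatch-partner-y : unmatch-partner y ≡ y
    unmatch-partner-y rewrite ==-≢ x-mat | ==-refl y = refl

    unmatch-partner-other : ∀ {z} → z ≢ x → z ≢ y → unmatch-partner z ≡ σ z
    unmatch-partner-other z≢x z≢y rewrite ==-≢ z≢x | ==-≢ z≢y = refl

    unmatch : Matching H
    unmatch = record
      { partner            = unmatch-partner
      ; partner-involutive = involutive
      ; partner-adjacent   = adjacent
      }
      where
      involutive : ∀ z → unmatch-partner (unmatch-partner z) ≡ z
      involutive z with locate x y z
      ... | inj₁ refl                = trans (cong unmatch-partner unmatch-partner-x) unmatch-partner-x
      ... | inj₂ (inj₁ refl)         = trans (cong unmatch-partner unmatch-partner-y) unmatch-partner-y
      ... | inj₂ (inj₂ (z≢x , z≢y)) = begin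
        unmatch-partner (unmatch-partner z) ≡⟨ cong unmatch-partner (unmatch-partner-other z≢x z≢y) ⟩
        unmatch-partner (σ z)               ≡⟨ unmatch-partner-other σz≢x σz≢y ⟩
        σ (σ z)                             ≡⟨ partner-involutive M z ⟩
        z                                   ∎
        where
        open ≡-Reasoning
        σz≢x : σ z ≢ x
        σz≢x σz≡x = z≢y (trans (sym (partner-involutive M z)) (cong σ σz≡x))
        σz≢y : σ z ≢ y
        σz≢y = z≢x ∘ partner-injective M
      adjacent : ∀ z → unmatch-partner z ≢ z → adj H z (unmatch-partner z) ≡ true
      adjacent z z-mat with locate x y z
      ... | inj₁ refl                = ⊥-elim (z-mat unmatch-partner-x)
      ... | inj₂ (inj₁ refl)         = ⊥-elim (z-mat unmatch-partner-y)
      ... | inj₂ (inj₂ (z≢x , z≢y)) rewrite unmatch-partner-other z≢x z≢y =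
        partner-adjacent M z z-mat

    unmatch-exposes : #exposed M + 2 ≡ #exposed unmatch
    unmatch-exposes = count-drop-two (exposed unmatch) (exposed M) x≢y
      (exposed-true unmatch unmatch-partner-x) (exposed-true unmatch unmatch-partner-y)
      (exposed-false M x-mat)
      (exposed-false M (x≢y ∘ trans (sym (partner-involutive M x))))
      (λ z z≢x z≢y → sym (cong (_== z) (unmatch-partner-other z≢x z≢y)))

  module _ (M : Matching H) {a x : Fin n} (a-exp : partner M a ≡ a) (ax : adj H a x ≡ true)
           (x-mat : partner M x ≢ x) where

    private
      y = partner M x
      x≢a = adjacent⇒≢ H ax ∘ sym
      y≢a = partner-≢-exposed M a-exp x≢a
      M₁ = unmatch M x-mat
      a-exp₁ : partner M₁ a ≡ a
      a-exp₁ = trans (unmatch-partner-other M x-mat (x≢a ∘ sym) (y≢a ∘ sym)) a-exp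
      x-exp₁ : partner M₁ x ≡ x
      x-exp₁ = unmatch-partner-x M x-mat

    rotate : Matching H
    rotate = match M₁ a-exp₁ x-exp₁ ax

    rotate-#exposed : #exposed rotate ≡ #exposed M
    rotate-#exposed = +-cancelʳ-≡ 2 _ _
      (trans (match-augments M₁ a-exp₁ x-exp₁ ax) (sym (unmatch-exposes M x-mat)))

    rotate-frees : partner rotate y ≡ y
    rotate-frees = trans (match-partner-other M₁ a-exp₁ x-exp₁ ax y≢a x-mat)
                         (unmatch-partner-y M x-mat)

    rotate-keeps : ∀ {b} → partner M b ≡ b → b ≢ a → partner rotate b ≡ b
    rotate-keeps {b} b-exp b≢a =
      trans (match-partner-other M₁ a-exp₁ x-exp₁ ax b≢a b≢x)
            (trans (unmatch-partner-other M x-mat b≢x b≢y) b-exp)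
      where
      b≢x : b ≢ x
      b≢x refl = x-mat b-exp
      b≢y : b ≢ y
      b≢y = partner-≢-exposed M b-exp (b≢x ∘ sym) ∘ sym

  augment-along-path : (M : Matching H) {a b x : Fin n} → partner M a ≡ a → partner M b ≡ b →
                       a ≢ b → adj H a x ≡ true → partner M x ≢ x →
                       adj H b (partner M x) ≡ true → Augmentation M
  augment-along-path M a-exp b-exp a≢b ax x-mat by =
    transport-augmentation {M = M} {M′} (rotate-#exposed M a-exp ax x-mat)
      (augment-by-edge M′ (rotate-keeps M a-exp ax x-mat b-exp (a≢b ∘ sym))
                          (rotate-frees M a-exp ax x-mat) by)
    where M′ = rotate M a-exp ax x-mat

  -- No augmenting path of length 1 or 3 joins a and b.
  Blocked : Matching H → Fin n → Fin n → Set
  Blocked M a b = (∀ z → adj H a z ≡ true → partner M z ≢ z)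
                × (∀ z → adj H b z ≡ true → partner M z ≢ z)
                × (∀ x → adj H a x ≡ true → adj H b (partner M x) ≢ true)

  blocked-sym : (M : Matching H) {a b : Fin n} → Blocked M a b → Blocked M b a
  blocked-sym M (a-full , b-full , no-path) = b-full , a-full , λ x bx ay →
    no-path (partner M x) ay (subst (λ z → adj H _ z ≡ true) (sym (partner-involutive M x)) bx)

  augment-or-blocked : (M : Matching H) {a b : Fin n} → partner M a ≡ a → partner M b ≡ b →
                       a ≢ b →
                       Augmentation M ⊎ Blocked M a b
  augment-or-blocked M {a} {b} a-exp b-exp a≢b
    with any? (λ z → (adj H a z ≟ᵇ true) ×-dec (partner M z ≟ z))
  ... | yes (z , az , z-exp) = inj₁ (augment-by-edge M a-exp z-exp az)
  ... | no a-full with any? (λ z → (adj H b z ≟ᵇ true) ×-dec (partner M z ≟ z))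
  ... | yes (z , bz , z-exp) = inj₁ (augment-by-edge M b-exp z-exp bz)
  ... | no b-full with any? (λ x → (adj H a x ≟ᵇ true) ×-dec (adj H b (partner M x) ≟ᵇ true))
  ... | yes (x , ax , by) =
    inj₁ (augment-along-path M a-exp b-exp a≢b ax (λ x-exp → a-full (x , ax , x-exp)) by)
  ... | no no-path = inj₂ ( (λ z az z-exp → a-full (z , az , z-exp))
                          , (λ z bz z-exp → b-full (z , bz , z-exp))
                          , (λ x ax by → no-path (x , ax , by)))

  three-exposed : (M : Matching H) {a b c : Fin n} → partner M a ≡ a → partner M b ≡ b →
                  partner M c ≡ c → a ≢ b → a ≢ c → b ≢ c → 3 ≤ #exposed M
  three-exposed M {a} {b} {c} a-exp b-exp c-exp a≢b a≢c b≢c =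
    subst (_≤ #exposed M) three
      (count+two-points-≤-sum (𝟙 ∘ exposed M) (_== c) a≢b (==-≢ a≢c) (==-≢ b≢c) c-counted)
    where
    three : count (_== c) + 𝟙 (exposed M a) + 𝟙 (exposed M b) ≡ 3
    three rewrite sum-δ c | exposed-true M a-exp | exposed-true M b-exp = refl
    c-counted : ∀ i → i == c ≡ true → 1 ≤ 𝟙 (exposed M i)
    c-counted i i==c rewrite ==⇒≡ {x = i} {y = c} i==c | exposed-true M c-exp = ≤-refl

  blocked-degree-bound : (M : Matching H) {a b c : Fin n} →
                         partner M a ≡ a → partner M b ≡ b → partner M c ≡ c →
                         a ≢ b → a ≢ c → b ≢ c → Blocked M a b → deg H a + deg H b + 3 ≤ n
  blocked-degree-bound M {a} {b} {c} a-exp b-exp c-exp a≢b a≢c b≢c (a-full , b-full , no-path) = begin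
    deg H a + deg H b + 3
      ≡⟨ cong₂ (λ p q → p + q + 3) (deg≡count H a)
               (trans (deg≡count H b) (sym (sum-involution σ (partner-involutive M) (𝟙 ∘ adj H b)))) ⟩
    count (adj H a) + count (adj H b ∘ σ) + 3
      ≡⟨ cong (_+ 3) (∑-distrib-+ (𝟙 ∘ adj H a) (𝟙 ∘ adj H b ∘ σ)) ⟨
    sum (λ i → 𝟙 (adj H a i) + 𝟙 (adj H b (σ i))) + 3
      ≤⟨ +-mono-≤ (sum-mono-≤ pointwise) (three-exposed M a-exp b-exp c-exp a≢b a≢c b≢c) ⟩
    count (not ∘ exposed M) + #exposed M
      ≡⟨ count-complement (exposed M) ⟩
    n ∎
    where
    open ≤-Reasoning
    σ = partner M
    pointwise : ∀ i → 𝟙 (adj H a i) + 𝟙 (adj H b (σ i)) ≤ 𝟙 (not (exposed M i))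
    pointwise i with adj H a i in ai | adj H b (σ i) in bσi
    ... | true  | true  = ⊥-elim (no-path i ai bσi)
    ... | true  | false rewrite exposed-false M (a-full i ai) = ≤-refl
    ... | false | true  rewrite exposed-false M {i} (λ σi≡i →
                                  b-full (σ i) bσi (trans (partner-involutive M i) (sym σi≡i))) = ≤-refl
    ... | false | false = z≤n

  exposed-avoiding : (M : Matching H) (Q : Fin n → Bool) → count Q < #exposed M →
                     ∃ λ a → partner M a ≡ a × Q a ≡ false
  exposed-avoiding M Q Q<#exp = let a , a-exp , Qa = count-exceeds (exposed M) Q Q<#exp
                                in a , ==⇒≡ {x = partner M a} a-exp , Qa

  exposed-pair-avoiding : (M : Matching H) (c : Fin n) → 3 ≤ #exposed M →
                          ∃₂ λ a b → partner M a ≡ a × partner M b ≡ b × a ≢ b × a ≢ c × b ≢ c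
  exposed-pair-avoiding M c 3≤#exp
    with exposed-avoiding M (_== c)
           (subst (_< #exposed M) (sym (sum-δ c)) (≤-trans (s≤s (s≤s z≤n)) 3≤#exp))
  ... | a , a-exp , a==c with exposed-avoiding M (λ i → i == c ∨ i == a) two<#exp
    where
    two<#exp : count (λ i → i == c ∨ i == a) < #exposed M
    two<#exp = ≤-<-trans (count-∨-≤ (_== c) (_== a))
                 (subst (_< #exposed M) (sym (cong₂ _+_ (sum-δ c) (sum-δ a))) 3≤#exp)
  ...   | b , b-exp , b==c∨a =
    a , b , a-exp , b-exp , ==-false⇒≢ (∨-conicalʳ _ _ b==c∨a) ∘ sym ,
    ==-false⇒≢ a==c , ==-false⇒≢ (∨-conicalˡ _ _ b==c∨a)

  augment-until-one-exposed : (∀ M → 3 ≤ #exposed M → Augmentation M) →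
                              ∀ k (M : Matching H) → #exposed M ≡ suc (2 * k) →
                              Σ (Matching H) λ M′ → #exposed M′ ≡ 1
  augment-until-one-exposed augment zero    M #exp≡1 = M , #exp≡1
  augment-until-one-exposed augment (suc k) M #exp≡ =
    let M′ , #exp′+2≡ = augment M (subst (3 ≤_) (sym (trans #exp≡ (odd-suc k))) (m≤m+n 3 (2 * k)))
    in augment-until-one-exposed augment k M′
         (+-cancelʳ-≡ 2 _ _ (trans #exp′+2≡ (trans #exp≡ (trans (odd-suc k) (+-comm 2 _)))))
    where
    odd-suc : ∀ k → suc (2 * suc k) ≡ 2 + suc (2 * k)
    odd-suc = solve-∀

  isolated-exposed : (M : Matching H) {c : Fin n} → (∀ y → adj H c y ≡ false) → partner M c ≡ c
  isolated-exposed M {c} isolated with partner M c ≟ c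
  ... | yes c-exp = c-exp
  ... | no c-mat with trans (sym (partner-adjacent M c c-mat)) (isolated (partner M c))
  ...   | ()

  only-exposed : (M : Matching H) {c : Fin n} → #exposed M ≡ 1 → partner M c ≡ c →
                 ∀ x → x ≢ c → partner M x ≢ x
  only-exposed M {c} #exp≡1 c-exp x x≢c x-exp =
    1+n≰n (subst₂ (λ p q → 𝟙 p + 𝟙 q ≤ 1) (exposed-true M c-exp) (exposed-true M x-exp)
             (subst (𝟙 (exposed M c) + 𝟙 (exposed M x) ≤_) #exp≡1
                    (two-points-≤-sum (𝟙 ∘ exposed M) (x≢c ∘ sym))))

-- Deleting a vertex and an edge

joins : ∀ {n} {G : Graph n} → Edge G → Fin n → Fin n → Bool
joins e x y = (x == end₁ e ∧ y == end₂ e) ∨ (x == end₂ e ∧ y == end₁ e)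

joins-sym : ∀ {n} {G : Graph n} (e : Edge G) x y → joins e x y ≡ joins e y x
joins-sym e x y = trans (∨-comm (x == e₁ ∧ y == e₂) (x == e₂ ∧ y == e₁))
                         (cong₂ _∨_ (∧-comm (x == e₂) (y == e₁)) (∧-comm (x == e₁) (y == e₂)))
  where e₁ = end₁ e
        e₂ = end₂ e

_−_−_ : ∀ {n} (G : Graph n) → Fin n → Edge G → Graph n
G − v − e = record
  { adj    = adjacent
  ; sym    = adjacent-sym
  ; irrefl = λ x → cong (_∧ not (x == v) ∧ not (x == v) ∧ not (joins e x x)) (irrefl G x)
  }
  where
  adjacent : _ → _ → Bool
  adjacent x y = adj G x y ∧ not (x == v) ∧ not (y == v) ∧ not (joins e x y)
  ∧-swap : ∀ p q s → p ∧ q ∧ s ≡ q ∧ p ∧ s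
  ∧-swap true  q s = refl
  ∧-swap false q s = sym (∧-zeroʳ q)
  adjacent-sym : ∀ x y → adjacent x y ≡ adjacent y x
  adjacent-sym x y rewrite adj-sym G x y | joins-sym e x y =
    cong (adj G y x ∧_) (∧-swap (not (x == v)) (not (y == v)) (not (joins e y x)))

module _ {n} (G : Graph n) (v : Fin n) (e : Edge G) where

  private
    e₁ = end₁ e
    e₂ = end₂ e

  removed-vertex-isolated : ∀ y → adj (G − v − e) v y ≡ false
  removed-vertex-isolated y rewrite ==-refl v = ∧-zeroʳ (adj G v y)

  removed-vertex-exposed : (M : Matching (G − v − e)) → partner M v ≡ v
  removed-vertex-exposed M = isolated-exposed M removed-vertex-isolated

  joins-same-edge : ∀ {x y} → SameEdge e x y → joins e x y ≡ true
  joins-same-edge (inj₁ (refl , refl)) rewrite ==-refl e₁ | ==-refl e₂ = refl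
  joins-same-edge (inj₂ (refl , refl)) rewrite ==-refl e₁ | ==-refl e₂ =
    ∨-zeroʳ (e₂ == e₁ ∧ e₁ == e₂)

  adjacent-after-removal : ∀ {x y} → adj (G − v − e) x y ≡ true →
                           adj G x y ≡ true × y ≢ v × ¬ SameEdge e x y
  adjacent-after-removal {x} {y} xy =
    ∧-conicalˡ _ _ xy , ==-false⇒≢ (not-true (∧-conicalˡ _ _ y-kept)) ,
    λ same → not-¬ (joins-same-edge same) (not-true (∧-conicalʳ _ _ y-kept))
    where
    not-true : ∀ {p} → not p ≡ true → p ≡ false
    not-true {false} _ = refl
    x-kept = ∧-conicalʳ (adj G x y) _ xy
    y-kept = ∧-conicalʳ (not (x == v)) (not (y == v) ∧ not (joins e x y)) x-kept

  count-joins : ∀ x → count (joins e x) ≤ δ e₁ x + δ e₂ x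
  count-joins x = begin
    count (joins e x)
      ≤⟨ sum-mono-≤ (λ y → ∨∧-≤ (x == e₁) (y == e₂) (x == e₂) (y == e₁)) ⟩
    sum (λ y → δ e₁ x * δ e₂ y + δ e₂ x * δ e₁ y)
      ≡⟨ ∑-distrib-+ (λ y → δ e₁ x * δ e₂ y) (λ y → δ e₂ x * δ e₁ y) ⟩
    sum (λ y → δ e₁ x * δ e₂ y) + sum (λ y → δ e₂ x * δ e₁ y)
      ≡⟨ cong₂ _+_ (sum-scaled-δ (δ e₁ x) e₂) (sum-scaled-δ (δ e₂ x) e₁) ⟩
    δ e₁ x + δ e₂ x ∎
    where
    open ≤-Reasoning
    ∨∧-≤ : ∀ p q r s → 𝟙 ((p ∧ q) ∨ (r ∧ s)) ≤ 𝟙 p * 𝟙 q + 𝟙 r * 𝟙 s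
    ∨∧-≤ true  true  r     s     = s≤s z≤n
    ∨∧-≤ true  false true  true  = ≤-refl
    ∨∧-≤ true  false true  false = z≤n
    ∨∧-≤ true  false false s     = z≤n
    ∨∧-≤ false q     true  true  = ≤-refl
    ∨∧-≤ false q     true  false = z≤n
    ∨∧-≤ false q     false s     = z≤n

  deg-before-removal : ∀ {x} → x ≢ v → deg G x ≤ deg (G − v − e) x + 1 + (δ e₁ x + δ e₂ x)
  deg-before-removal {x} x≢v = begin
    deg G x
      ≡⟨ deg≡count G x ⟩
    count (adj G x)
      ≤⟨ sum-mono-≤ pointwise ⟩
    sum (λ y → 𝟙 (adj (G − v − e) x y) + δ v y + 𝟙 (joins e x y))
      ≡⟨ ∑-distrib-+ (λ y → 𝟙 (adj (G − v − e) x y) + δ v y) (λ y → 𝟙 (joins e x y)) ⟩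
    sum (λ y → 𝟙 (adj (G − v − e) x y) + δ v y) + count (joins e x)
      ≡⟨ cong (_+ count (joins e x)) (∑-distrib-+ (λ y → 𝟙 (adj (G − v − e) x y)) (δ v)) ⟩
    count (adj (G − v − e) x) + sum (δ v) + count (joins e x)
      ≡⟨ cong₂ (λ d s → d + s + count (joins e x)) (deg≡count (G − v − e) x) (sym (sum-δ v)) ⟨
    deg (G − v − e) x + 1 + count (joins e x)
      ≤⟨ +-monoʳ-≤ (deg (G − v − e) x + 1) (count-joins x) ⟩
    deg (G − v − e) x + 1 + (δ e₁ x + δ e₂ x) ∎
    where
    open ≤-Reasoning
    split : ∀ p q s → 𝟙 p ≤ 𝟙 (p ∧ not q ∧ not s) + 𝟙 q + 𝟙 s
    split false q     s     = z≤n
    split true  true  s     = s≤s z≤n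
    split true  false true  = s≤s z≤n
    split true  false false = s≤s z≤n
    pointwise : ∀ y → 𝟙 (adj G x y) ≤ 𝟙 (adj (G − v − e) x y) + δ v y + 𝟙 (joins e x y)
    pointwise y rewrite ==-≢ x≢v = split (adj G x y) (y == v) (joins e x y)

-- Nearly regular graphs

module NearlyRegularDeletion {n} (G : Graph n) (v : Fin n) (e : Edge G) {r : ℕ} (w : Fin n)
                  (w-deg : deg G w ≡ r ∸ 1) (others-deg : ∀ x → x ≢ w → deg G x ≡ r)
                  (4≤r : 4 ≤ r) (n≤2r∸1 : n ≤ 2 * r ∸ 1) where

  private
    H = G − v − e
    e₁ = end₁ e
    e₂ = end₂ e

  defect : Fin n → ℕ
  defect x = δ w x + δ e₁ x + δ e₂ x

  sum-defect : sum defect ≡ 3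
  sum-defect = begin
    sum defect
      ≡⟨ ∑-distrib-+ (λ x → δ w x + δ e₁ x) (δ e₂) ⟩
    sum (λ x → δ w x + δ e₁ x) + sum (δ e₂)
      ≡⟨ cong (_+ sum (δ e₂)) (∑-distrib-+ (δ w) (δ e₁)) ⟩
    sum (δ w) + sum (δ e₁) + sum (δ e₂)
      ≡⟨ cong₂ _+_ (cong₂ _+_ (sum-δ w) (sum-δ e₁)) (sum-δ e₂) ⟩
    3 ∎
    where open ≡-Reasoning

  defect≤2 : ∀ x → defect x ≤ 2
  defect≤2 x = subst (_≤ 2) (sym (+-assoc (δ w x) _ _)) (+-mono-≤ (𝟙≤1 (x == w)) endpoints≤1)
    where
    𝟙≤1 : ∀ p → 𝟙 p ≤ 1
    𝟙≤1 true  = ≤-refl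
    𝟙≤1 false = z≤n
    endpoints≤1 : δ e₁ x + δ e₂ x ≤ 1
    endpoints≤1 with x ≟ e₁
    ... | yes refl rewrite ==-≢ (adjacent⇒≢ G (isEdge e)) = ≤-refl
    ... | no _     = 𝟙≤1 (x == e₂)

  degree-lower-bound : ∀ {x} → x ≢ v → r ≤ deg H x + 1 + defect x
  degree-lower-bound {x} x≢v = begin
    r                                        ≤⟨ regular-bound ⟩
    deg G x + δ w x                          ≤⟨ +-monoˡ-≤ (δ w x) (deg-before-removal G v e x≢v) ⟩
    deg H x + 1 + (δ e₁ x + δ e₂ x) + δ w x  ≡⟨ rearrange (deg H x) (δ w x) (δ e₁ x) (δ e₂ x) ⟩
    deg H x + 1 + defect x                   ∎
    where
    open ≤-Reasoning
    rearrange : ∀ d a b c → d + 1 + (b + c) + a ≡ d + 1 + (a + b + c)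
    rearrange = solve-∀
    regular-bound : r ≤ deg G x + δ w x
    regular-bound with x ≟ w
    ... | yes refl rewrite w-deg = ≤-trans (m≤n+m∸n r 1) (≤-reflexive (+-comm 1 (r ∸ 1)))
    ... | no x≢w   rewrite others-deg x x≢w = m≤m+n r 0

  n<2r : n < 2 * r
  n<2r = ≤-<-trans n≤2r∸1 (∸-monoʳ-< (s≤s z≤n) 1≤2r)
    where
    1≤2r : 1 ≤ 2 * r
    1≤2r = ≤-trans (≤-trans (s≤s z≤n) 4≤r) (m≤m+n r (r + 0))

  blocked-pair-defect : (M : Matching H) {a b : Fin n} → partner M a ≡ a → partner M b ≡ b →
                        a ≢ b → a ≢ v → b ≢ v → Blocked M a b → 2 ≤ defect a + defect b
  blocked-pair-defect M {a} {b} a-exp b-exp a≢b a≢v b≢v blocked =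
    +-cancelʳ-≤ 2 2 (defect a + defect b) (+-cancelˡ-< (deg H a + deg H b) 3 _ degree-chain)
    where
    open ≤-Reasoning
    rearrange : ∀ d d′ l l′ → d + 1 + l + (d′ + 1 + l′) ≡ d + d′ + (l + l′ + 2)
    rearrange = solve-∀
    degree-chain : deg H a + deg H b + 3 < deg H a + deg H b + (defect a + defect b + 2)
    degree-chain = begin-strict
      deg H a + deg H b + 3
        ≤⟨ blocked-degree-bound M a-exp b-exp (removed-vertex-exposed G v e M) a≢b a≢v b≢v blocked ⟩
      n
        <⟨ n<2r ⟩
      r + (r + 0)
        ≤⟨ +-mono-≤ (degree-lower-bound a≢v)
                    (≤-trans (≤-reflexive (+-identityʳ r)) (degree-lower-bound b≢v)) ⟩
      deg H a + 1 + defect a + (deg H b + 1 + defect b)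
        ≡⟨ rearrange (deg H a) (deg H b) (defect a) (defect b) ⟩
      deg H a + deg H b + (defect a + defect b + 2) ∎

  module _ (M : Matching H) {a b : Fin n} (a-exp : partner M a ≡ a) (b-exp : partner M b ≡ b)
           (a≢b : a ≢ b) (a≢v : a ≢ v) (blocked : Blocked M a b) where

    private
      σ = partner M

    neighbour-partner-fresh : ∀ {x} → adj H a x ≡ true → σ x ≢ a × σ x ≢ b
    neighbour-partner-fresh {x} ax =
      partner-≢-exposed M a-exp (adjacent⇒≢ H ax ∘ sym) ,
      partner-≢-exposed M b-exp (λ { refl → proj₁ blocked x ax b-exp })

    rotation-target-defect-free : 2 ≤ defect a → defect b ≡ 0 →
                                  ∃ λ x → adj H a x ≡ true × defect (σ x) + defect b ≤ 1
    rotation-target-defect-free 2≤da db≡0 =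
      x , ax , subst (λ d → defect (σ x) + d ≤ 1) (sym db≡0)
                 (subst (_≤ 1) (sym (+-identityʳ _)) (+-cancelˡ-≤ 2 _ 1 two-defects))
      where
      1≤deg : 1 ≤ deg H a
      1≤deg = +-cancelʳ-≤ 3 1 (deg H a) (begin
        4                       ≤⟨ 4≤r ⟩
        r                       ≤⟨ degree-lower-bound a≢v ⟩
        deg H a + 1 + defect a  ≤⟨ +-monoʳ-≤ (deg H a + 1) (defect≤2 a) ⟩
        deg H a + 1 + 2         ≡⟨ +-assoc (deg H a) 1 2 ⟩
        deg H a + 3             ∎)
        where open ≤-Reasoning
      witness = count-witness (adj H a) (subst (0 <_) (deg≡count H a) 1≤deg)
      x = proj₁ witness
      ax = proj₂ witness
      two-defects : 2 + defect (σ x) ≤ 2 + 1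
      two-defects = ≤-trans (+-monoˡ-≤ (defect (σ x)) 2≤da)
                      (subst (defect a + defect (σ x) ≤_) sum-defect
                        (two-points-≤-sum defect (proj₁ (neighbour-partner-fresh ax) ∘ sym)))

    rotation-target-defective : defect b ≤ defect a → 1 ≤ defect b →
                                ∃ λ x → adj H a x ≡ true × defect (σ x) + defect b ≤ 1
    rotation-target-defective db≤da 1≤db =
      x , ax , subst (λ d → d + defect b ≤ 1) (sym σx-defect-free) db≤1
      where
      open ≤-Reasoning
      positive : Fin n → Bool
      positive y = not (y == a) ∧ not (y == b) ∧ (0 <ᵇ defect y)
      positive-defect : ∀ y → positive y ≡ true → 1 ≤ defect y
      positive-defect y py = <ᵇ⇒< 0 (defect y) (subst T (sym (∧-conicalʳ (not (y == b)) _
                                                     (∧-conicalʳ (not (y == a)) _ py))) tt)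
      positive-bound : count positive + defect a + defect b ≤ 3
      positive-bound = subst (count positive + defect a + defect b ≤_) sum-defect
        (count+two-points-≤-sum defect positive a≢b positive-a positive-b positive-defect)
        where
        positive-a : positive a ≡ false
        positive-a rewrite ==-refl a = refl
        positive-b : positive b ≡ false
        positive-b rewrite ==-≢ (a≢b ∘ sym) | ==-refl b = refl
      rearrange : ∀ p d → suc p + (d + 1) ≡ p + d + 1 + 1
      rearrange = solve-∀
      positive<deg : count positive < deg H a
      positive<deg = +-cancelʳ-≤ (defect a + 1) (suc (count positive)) (deg H a) (begin
        suc (count positive) + (defect a + 1)     ≡⟨ rearrange (count positive) (defect a) ⟩
        count positive + defect a + 1 + 1
          ≤⟨ +-monoˡ-≤ 1 (+-monoʳ-≤ (count positive + defect a) 1≤db) ⟩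
        count positive + defect a + defect b + 1  ≤⟨ +-monoˡ-≤ 1 positive-bound ⟩
        4                                         ≤⟨ 4≤r ⟩
        r                                         ≤⟨ degree-lower-bound a≢v ⟩
        deg H a + 1 + defect a                    ≡⟨ +-assoc (deg H a) 1 (defect a) ⟩
        deg H a + (1 + defect a)                  ≡⟨ cong (deg H a +_) (+-comm 1 (defect a)) ⟩
        deg H a + (defect a + 1)                  ∎)
      witness = count-exceeds (adj H a) (positive ∘ σ)
        (subst₂ _<_ (sym (sum-involution σ (partner-involutive M) (𝟙 ∘ positive))) (deg≡count H a)
          positive<deg)
      x = proj₁ witness
      ax = proj₁ (proj₂ witness)
      non-positive : ∀ {y} → positive y ≡ false → y ≢ a → y ≢ b → defect y ≡ 0
      non-positive {y} py y≢a y≢b rewrite ==-≢ y≢a | ==-≢ y≢b with defect y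
      ... | zero = refl
      σx-defect-free : defect (σ x) ≡ 0
      σx-defect-free = let σx≢a , σx≢b = neighbour-partner-fresh ax in
                       non-positive (proj₂ (proj₂ witness)) σx≢a σx≢b
      db≤1 : defect b ≤ 1
      db≤1 = half (defect b) (≤-trans (+-monoˡ-≤ (defect b) db≤da)
               (subst (defect a + defect b ≤_) sum-defect (two-points-≤-sum defect a≢b)))
        where
        half : ∀ m → m + m ≤ 3 → m ≤ 1
        half zero          _ = z≤n
        half (suc zero)    _ = ≤-refl
        half (suc (suc m)) h = ⊥-elim (1+n≰n (≤-trans (+-mono-≤ 2≤m+2 2≤m+2) h))
          where
          2≤m+2 : 2 ≤ suc (suc m)
          2≤m+2 = s≤s (s≤s z≤n)

  rotation-target : (M : Matching H) {a b : Fin n} → partner M a ≡ a → partner M b ≡ b →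
                    a ≢ b → a ≢ v → Blocked M a b →
                    2 ≤ defect a + defect b → defect b ≤ defect a →
                    ∃ λ x → adj H a x ≡ true × defect (partner M x) + defect b ≤ 1
  rotation-target M {a} {b} a-exp b-exp a≢b a≢v blocked 2≤da+db db≤da with defect b ≟ℕ 0
  ... | yes db≡0 = rotation-target-defect-free M a-exp b-exp a≢b a≢v blocked
                     (subst (2 ≤_) (trans (cong (defect a +_) db≡0) (+-identityʳ (defect a))) 2≤da+db)
                     db≡0
  ... | no db≢0  = rotation-target-defective M a-exp b-exp a≢b a≢v blocked db≤da (n≢0⇒n>0 db≢0)

  augment-after-rotation : (M : Matching H) {a b x : Fin n} → partner M a ≡ a → partner M b ≡ b →
                           a ≢ b → b ≢ v → adj H a x ≡ true → partner M x ≢ x →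
                           defect (partner M x) + defect b ≤ 1 → Augmentation M
  augment-after-rotation M {a} {b} {x} a-exp b-exp a≢b b≢v ax x-mat light =
    [ transport-augmentation {M = M} {M′} (rotate-#exposed M a-exp ax x-mat) , ⊥-elim ∘ not-blocked ]′
      (augment-or-blocked M′ y-exp′ b-exp′ y≢b)
    where
    M′ = rotate M a-exp ax x-mat
    y-exp′ = rotate-frees M a-exp ax x-mat
    b-exp′ = rotate-keeps M a-exp ax x-mat b-exp (a≢b ∘ sym)
    y≢b : partner M x ≢ b
    y≢b = partner-≢-exposed M b-exp (λ { refl → x-mat b-exp })
    y≢v = proj₁ (proj₂ (adjacent-after-removal G v e (partner-adjacent M x x-mat)))
    not-blocked : ¬ Blocked M′ (partner M x) b
    not-blocked blocked′ =
      1+n≰n (≤-trans (blocked-pair-defect M′ y-exp′ b-exp′ y≢b y≢v b≢v blocked′) light)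

  augment-blocked-pair : (M : Matching H) {a b : Fin n} → partner M a ≡ a → partner M b ≡ b →
                         a ≢ b → a ≢ v → b ≢ v → Blocked M a b → defect b ≤ defect a →
                         Augmentation M
  augment-blocked-pair M a-exp b-exp a≢b a≢v b≢v blocked db≤da =
    let x , ax , light = rotation-target M a-exp b-exp a≢b a≢v blocked
                           (blocked-pair-defect M a-exp b-exp a≢b a≢v b≢v blocked) db≤da
    in augment-after-rotation M a-exp b-exp a≢b b≢v ax (proj₁ blocked x ax) light

  augment-pair : (M : Matching H) {a b : Fin n} → partner M a ≡ a → partner M b ≡ b →
                 a ≢ b → a ≢ v → b ≢ v → Augmentation M
  augment-pair M {a} {b} a-exp b-exp a≢b a≢v b≢v with augment-or-blocked M a-exp b-exp a≢b
  ... | inj₁ augmentation = augmentation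
  ... | inj₂ blocked with defect b ≤? defect a
  ...   | yes db≤da = augment-blocked-pair M a-exp b-exp a≢b a≢v b≢v blocked db≤da
  ...   | no db≰da  = augment-blocked-pair M b-exp a-exp (a≢b ∘ sym) b≢v a≢v (blocked-sym M blocked)
                        (<⇒≤ (≰⇒> db≰da))

  augment : (M : Matching H) → 3 ≤ #exposed M → Augmentation M
  augment M 3≤#exp =
    let a , b , a-exp , b-exp , a≢b , a≢v , b≢v = exposed-pair-avoiding M v 3≤#exp
    in augment-pair M a-exp b-exp a≢b a≢v b≢v

  one-exposed-matching : ∀ k → n ≡ suc (2 * k) → Σ (Matching H) λ M → #exposed M ≡ 1
  one-exposed-matching k n≡2k+1 =
    augment-until-one-exposed augment k empty-matching (trans (#exposed-empty {H = H}) n≡2k+1)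

lemma3p5 : (r n : ℕ) → 4 ≤ r → (G : Graph n) → NearlyRegular r G →
    n ≤ 2 * r ∸ 1 → Odd n →
    (v : Fin n) (e : Edge G) → PerfectMatchingMinus G v e
lemma3p5 r n 4≤r G (w , w-deg , others-deg) n≤2r∸1 (k , n≡2k+1) v e
  with NearlyRegularDeletion.one-exposed-matching G v e w w-deg others-deg 4≤r n≤2r∸1 k n≡2k+1
... | M , #exp≡1 = partner M , λ x x≢v →
  let x-matched = only-exposed M #exp≡1 (removed-vertex-exposed G v e M) x x≢v
      G-adj , partner≢v , not-e = adjacent-after-removal G v e (partner-adjacent M x x-matched)
  in partner≢v , partner-involutive M x , G-adj , not-e
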